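{- For integers $n\ge 2$ and $a,b\ge1$ with $a+b\le n$, setting $c=n-a-b$, $$P(a,b;n) \le \frac{1}{2\pi}\,\frac{\sqrt{n}}{a\left(a-\frac34\right)^{1/2} b\left(b-\frac34\right)^{1/2}\left(c+\frac14\right)^{1/2}}.$$
   Context: $\mathcal{T}^{\mathrm{planar}}_{n,v}$ is the finite set of pairs $(T,v)$ where $T$ is a rooted binary planar tree (every internal vertex has exactly two children, ordered left and right) with $n$ unlabelled leaves, up to planar isomorphism, and $v$ is an internal vertex of $T$; $\ell(v)$ and $r(v)$ are the numbers of leaves descending from the left and right child of $v$. $P(a,b;n)$ is the probability that a uniformly random $(T,v)\in\mathcal{T}^{\mathrm{planar}}_{n,v}$ has $\ell(v)=a$ and $r(v)=b$. -}

module Defs where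

open import Data.Nat as ℕ using (ℕ; zero; suc; _+_; _*_; _≟_)
open import Data.Integer using (+_)
open import Data.Rational as ℚ using (ℚ; _/_; 0ℚ)
open import Data.List using (List; []; _∷_; concatMap; filter; length; map)
open import Data.Product using (_×_; _,_)
open import Relation.Nullary.Decidable using (_×-dec_)

-- Rooted binary planar trees with unlabelled leaves.  Planar isomorphism
-- classes correspond exactly to elements of this inductive type
-- (left/right children are ordered).
data Tree : Set where
  leaf : Tree
  node : Tree → Tree → Tree

leaves : Tree → ℕ
leaves leaf       = 1
leaves (node l r) = leaves l + leaves r

treesUpTo : ℕ → List Tree
treesUpTo zero    = leaf ∷ []
treesUpTo (suc d) =
  leaf ∷ concatMap (λ l → map (node l) (treesUpTo d)) (treesUpTo d)

-- All planar binary trees with n leaves (a tree with n leaves has height < n).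
trees : ℕ → List Tree
trees n = filter (λ t → leaves t ≟ n) (treesUpTo n)

internalLR : Tree → List (ℕ × ℕ)
internalLR leaf       = []
internalLR (node l r) = (leaves l , leaves r) ∷ (internalLR l Data.List.++ internalLR r)

-- The multiset {(ℓ(v), r(v)) : (T, v) ∈ 𝒯^planar_{n,v}}, one entry per pair (T,v).
markedLR : ℕ → List (ℕ × ℕ)
markedLR n = concatMap internalLR (trees n)

-- ratio k m = k / m as a rational (0 if m = 0; never used with m = 0 here).
ratio : ℕ → ℕ → ℚ
ratio k zero    = 0ℚ
ratio k (suc m) = (+ k) / suc m

-- P(a,b;n): probability that a uniformly random (T,v) ∈ 𝒯^planar_{n,v}
-- has ℓ(v) = a and r(v) = b.
P : ℕ → ℕ → ℕ → ℚ
P a b n =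
  ratio (length (filter (λ p → (Data.Product.proj₁ p ≟ a) ×-dec (Data.Product.proj₂ p ≟ b)) (markedLR n)))
        (length (markedLR n))

-- Rational lower approximations of π (Leibniz series, partial sums ending
-- on a negative term):  piLower m = 4 Σ_{j=0}^{m} (1/(4j+1) − 1/(4j+3)).
-- They are strictly increasing and converge to π, so q ≤ ... for all of them
-- is the same as the inequality with π itself (by continuity).
piLower : ℕ → ℚ
piLower zero    = (+ 4) / 1 ℚ.* ((+ 1) / 1 ℚ.- (+ 1) / 3)
piLower (suc m) = piLower m ℚ.+ (+ 4) / 1 ℚ.* ((+ 1) / (4 * suc m + 1) ℚ.- (+ 1) / (4 * suc m + 3))

q : ℕ → ℚ
q k = (+ k) / 1

{-# OPTIONS --safe #-}
module Submission where

-- Write C(n) for the number of planar binary trees with n leaves and split every sum over trees at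
-- the root.  A statistic that is additive over the two subtrees then satisfies a convolution
-- recurrence X = h + X ⋆ C + C ⋆ X, which determines X.  Comparing solutions gives Rémy's identity
-- n C(n) = 2(2n-3) C(n-1) and shows that the (T,v) with ℓ(v) = a, r(v) = b number
-- C(a) C(b) (c+1) C(c+1) among (n-1) C(n).  With B_j = (j+1) C(j+1) = binom(2j, j), the sequence
-- B_j²(4j+1) / 16^j increases and 2 B_j²(2j+1) / 16^j decreases, both to 4/π.  Bounding the three
-- factors of P(a,b;n)² with these, and π by the Leibniz partial sum 52/15, gives the inequality.

open import Defs
open import Data.Bool using (true; false; if_then_else_)
open import Data.List using (List; []; _∷_; _++_; map; concatMap; filter; length)
open import Data.List.Properties using (length-++; filter-++)
open import Data.Nat using (ℕ; zero; suc; _+_; _*_; _∸_; _^_; _≤_; _<_; _≟_; _≡ᵇ_; z≤n; s≤s; NonZero)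
open import Data.Nat.Induction using (<-rec)
open import Data.Nat.Properties
open import Algebra.Properties.CommutativeSemigroup +-commutativeSemigroup
  using () renaming (interchange to +-interchange)
open import Algebra.Properties.CommutativeSemigroup *-commutativeSemigroup
  using () renaming (x∙yz≈y∙xz to *-left-comm)
open import Data.Nat.Tactic.RingSolver using (solve-∀)
open import Data.Product using (proj₁; proj₂)
open import Data.Rational using (ℚ; _/_) renaming (_*_ to _*ℚ_; _-_ to _-ℚ_; _+_ to _+ℚ_; _≤_ to _≤ℚ_)
open import Data.Rational as ℚ using (0ℚ; toℚᵘ; NonNegative; Positive)
import Data.Rational.Properties as ℚ
open import Data.Rational.Unnormalised as ℚᵘ using (mkℚᵘ; *≡*; *≤*)
import Data.Rational.Unnormalised.Properties as ℚᵘ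
open import Data.Sum using (_⊎_; inj₁; inj₂)
open import Function using (_∘_)
open import Level using (0ℓ)
open import Relation.Binary.PropositionalEquality
open import Relation.Nullary using (Dec; yes; no)
open import Relation.Nullary.Decidable using (_×-dec_; dec⇒maybe)
import Tactic.RingSolver
open import Tactic.RingSolver.Core.AlmostCommutativeRing using (AlmostCommutativeRing; fromCommutativeRing)

private
  variable
    X Y : Set

δ : ℕ → ℕ → ℕ
δ m n = if m ≡ᵇ n then 1 else 0

δ-cases : ∀ m n → δ m n ≡ 0 ⊎ m ≡ n
δ-cases zero    zero    = inj₂ refl
δ-cases zero    (suc n) = inj₁ refl
δ-cases (suc m) zero    = inj₁ refl
δ-cases (suc m) (suc n) with δ-cases m n
... | inj₁ δ≡0 = inj₁ δ≡0
... | inj₂ m≡n = inj₂ (cong suc m≡n)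

δ-sym : ∀ m n → δ m n ≡ δ n m
δ-sym zero    zero    = refl
δ-sym zero    (suc n) = refl
δ-sym (suc m) zero    = refl
δ-sym (suc m) (suc n) = δ-sym m n

δ-*-subst : ∀ m n (h : ℕ → ℕ) → δ m n * h m ≡ δ m n * h n
δ-*-subst m n h with δ-cases m n
... | inj₁ δ≡0  rewrite δ≡0 = refl
... | inj₂ refl = refl

δ-suc-∸ : ∀ m b → δ (suc b) m ≡ δ 1 (m ∸ b)
δ-suc-∸ zero    b       = cong (δ 1) (sym (0∸n≡0 b))
δ-suc-∸ (suc m) zero    = refl
δ-suc-∸ (suc m) (suc b) = δ-suc-∸ m b

δ-∸ : ∀ m k n → δ (m + suc k) n ≡ δ (suc k) (n ∸ m)
δ-∸ zero    k n       = refl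
δ-∸ (suc m) k zero    = refl
δ-∸ (suc m) k (suc n) = δ-∸ m k n

∑ : List X → (X → ℕ) → ℕ
∑ []       w = 0
∑ (x ∷ xs) w = w x + ∑ xs w

∑-++ : ∀ (xs ys : List X) w → ∑ (xs ++ ys) w ≡ ∑ xs w + ∑ ys w
∑-++ []       ys w = refl
∑-++ (x ∷ xs) ys w = trans (cong (w x +_) (∑-++ xs ys w)) (sym (+-assoc (w x) _ _))

∑-map : ∀ (f : X → Y) xs w → ∑ (map f xs) w ≡ ∑ xs (w ∘ f)
∑-map f []       w = refl
∑-map f (x ∷ xs) w = cong (w (f x) +_) (∑-map f xs w)

∑-concatMap : ∀ (f : X → List Y) xs w → ∑ (concatMap f xs) w ≡ ∑ xs (λ x → ∑ (f x) w)
∑-concatMap f []       w = refl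
∑-concatMap f (x ∷ xs) w =
  trans (∑-++ (f x) (concatMap f xs) w) (cong (∑ (f x) w +_) (∑-concatMap f xs w))

∑-cong : ∀ (xs : List X) {v w} → (∀ x → v x ≡ w x) → ∑ xs v ≡ ∑ xs w
∑-cong []       v≗w = refl
∑-cong (x ∷ xs) v≗w = cong₂ _+_ (v≗w x) (∑-cong xs v≗w)

∑-zero : ∀ (xs : List X) → ∑ xs (λ _ → 0) ≡ 0
∑-zero []       = refl
∑-zero (x ∷ xs) = ∑-zero xs

∑-+ : ∀ (xs : List X) v w → ∑ xs (λ x → v x + w x) ≡ ∑ xs v + ∑ xs w
∑-+ []       v w = refl
∑-+ (x ∷ xs) v w =
  trans (cong (v x + w x +_) (∑-+ xs v w)) (+-interchange (v x) (w x) (∑ xs v) (∑ xs w))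

∑-*ˡ : ∀ (xs : List X) k w → ∑ xs (λ x → k * w x) ≡ k * ∑ xs w
∑-*ˡ []       k w = sym (*-zeroʳ k)
∑-*ˡ (x ∷ xs) k w = trans (cong (k * w x +_) (∑-*ˡ xs k w)) (sym (*-distribˡ-+ k (w x) _))

∑-filter-≟ : ∀ (f : X → ℕ) n xs w →
             ∑ (filter (λ x → f x ≟ n) xs) w ≡ ∑ xs (λ x → δ (f x) n * w x)
∑-filter-≟ f n []       w = refl
∑-filter-≟ f n (x ∷ xs) w with f x ≡ᵇ n
... | true  = cong₂ _+_ (sym (+-identityʳ (w x))) (∑-filter-≟ f n xs w)
... | false = ∑-filter-≟ f n xs w

length-concatMap : ∀ (f : X → List Y) xs → length (concatMap f xs) ≡ ∑ xs (length ∘ f)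
length-concatMap f []       = refl
length-concatMap f (x ∷ xs) =
  trans (length-++ (f x)) (cong (length (f x) +_) (length-concatMap f xs))

length-filter-++ : ∀ {P : X → Set} (P? : ∀ x → Dec (P x)) xs ys →
  length (filter P? (xs ++ ys)) ≡ length (filter P? xs) + length (filter P? ys)
length-filter-++ P? xs ys = trans (cong length (filter-++ P? xs ys)) (length-++ (filter P? xs))

length-filter-concatMap : ∀ {P : Y → Set} (P? : ∀ y → Dec (P y)) (f : X → List Y) xs →
  length (filter P? (concatMap f xs)) ≡ ∑ xs (λ x → length (filter P? (f x)))
length-filter-concatMap P? f []       = refl
length-filter-concatMap P? f (x ∷ xs) = trans (length-filter-++ P? (f x) (concatMap f xs))
  (cong (length (filter P? (f x)) +_) (length-filter-concatMap P? f xs))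

sumTo : ℕ → (ℕ → ℕ) → ℕ
sumTo zero    h = h 0
sumTo (suc n) h = h 0 + sumTo n (h ∘ suc)

sumTo-cong : ∀ n {g h : ℕ → ℕ} → (∀ i → i ≤ n → g i ≡ h i) → sumTo n g ≡ sumTo n h
sumTo-cong zero    g≗h = g≗h 0 z≤n
sumTo-cong (suc n) g≗h = cong₂ _+_ (g≗h 0 z≤n) (sumTo-cong n (λ i i≤n → g≗h (suc i) (s≤s i≤n)))

sumTo-zero : ∀ n → sumTo n (λ _ → 0) ≡ 0
sumTo-zero zero    = refl
sumTo-zero (suc n) = sumTo-zero n

sumTo-+ : ∀ n (g h : ℕ → ℕ) → sumTo n (λ i → g i + h i) ≡ sumTo n g + sumTo n h
sumTo-+ zero    g h = refl
sumTo-+ (suc n) g h = trans (cong (g 0 + h 0 +_) (sumTo-+ n (g ∘ suc) (h ∘ suc)))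
                            (+-interchange (g 0) (h 0) _ _)

sumTo-*ˡ : ∀ n k (h : ℕ → ℕ) → sumTo n (λ i → k * h i) ≡ k * sumTo n h
sumTo-*ˡ zero    k h = refl
sumTo-*ˡ (suc n) k h =
  trans (cong (k * h 0 +_) (sumTo-*ˡ n k (h ∘ suc))) (sym (*-distribˡ-+ k (h 0) _))

sumTo-sucʳ : ∀ n (h : ℕ → ℕ) → sumTo (suc n) h ≡ sumTo n h + h (suc n)
sumTo-sucʳ zero    h = refl
sumTo-sucʳ (suc n) h = trans (cong (h 0 +_) (sumTo-sucʳ n (h ∘ suc))) (sym (+-assoc (h 0) _ _))

sumTo-reverse : ∀ n (h : ℕ → ℕ) → sumTo n h ≡ sumTo n (λ i → h (n ∸ i))
sumTo-reverse zero    h = refl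
sumTo-reverse (suc n) h = begin
  h 0 + sumTo n (h ∘ suc)
    ≡⟨ cong (h 0 +_) (sumTo-reverse n (h ∘ suc)) ⟩
  h 0 + sumTo n (λ i → h (suc (n ∸ i)))
    ≡⟨ cong (h 0 +_) (sumTo-cong n (λ i i≤n → cong h (sym (+-∸-assoc 1 i≤n)))) ⟩
  h 0 + sumTo n (λ i → h (suc n ∸ i))
    ≡⟨ +-comm (h 0) _ ⟩
  sumTo n (λ i → h (suc n ∸ i)) + h 0
    ≡⟨ cong (λ j → sumTo n (λ i → h (suc n ∸ i)) + h j) (sym (n∸n≡0 n)) ⟩
  sumTo n (λ i → h (suc n ∸ i)) + h (n ∸ n)
    ≡⟨ sym (sumTo-sucʳ n (λ i → h (suc n ∸ i))) ⟩
  sumTo (suc n) (λ i → h (suc n ∸ i)) ∎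
  where open ≡-Reasoning

sumTo-δ : ∀ n x (h : ℕ → ℕ) → x ≤ n → sumTo n (λ i → δ x i * h i) ≡ h x
sumTo-δ zero    zero    h _         = +-identityʳ (h 0)
sumTo-δ (suc n) zero    h _         =
  trans (cong (h 0 + 0 +_) (sumTo-zero n)) (trans (+-identityʳ _) (+-identityʳ _))
sumTo-δ (suc n) (suc x) h (s≤s x≤n) = sumTo-δ n x (h ∘ suc) x≤n

sumTo-δ-> : ∀ n x (h : ℕ → ℕ) → n < x → sumTo n (λ i → δ x i * h i) ≡ 0
sumTo-δ-> zero    (suc x) h _         = refl
sumTo-δ-> (suc n) (suc x) h (s≤s n<x) = sumTo-δ-> n x (h ∘ suc) n<x

∑-sumTo : ∀ (xs : List X) n (w : X → ℕ → ℕ) →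
          ∑ xs (λ x → sumTo n (w x)) ≡ sumTo n (λ i → ∑ xs (λ x → w x i))
∑-sumTo xs zero    w = refl
∑-sumTo xs (suc n) w = trans (∑-+ xs (λ x → w x 0) (λ x → sumTo n (w x ∘ suc)))
                             (cong (∑ xs (λ x → w x 0) +_) (∑-sumTo xs n (λ x → w x ∘ suc)))

-- Convolution recurrences

infixl 7 _⋆_

_⋆_ : (ℕ → ℕ) → (ℕ → ℕ) → ℕ → ℕ
(F ⋆ G) n = sumTo n (λ i → F i * G (n ∸ i))

⋆-cong : ∀ {F F′ G G′ : ℕ → ℕ} → (∀ i → F i ≡ F′ i) → (∀ i → G i ≡ G′ i) →
         ∀ n → (F ⋆ G) n ≡ (F′ ⋆ G′) n
⋆-cong F≗F′ G≗G′ n = sumTo-cong n (λ i _ → cong₂ _*_ (F≗F′ i) (G≗G′ (n ∸ i)))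

⋆-comm : ∀ F G n → (F ⋆ G) n ≡ (G ⋆ F) n
⋆-comm F G n = trans (sumTo-reverse n (λ i → F i * G (n ∸ i)))
  (sumTo-cong n (λ i i≤n → trans (cong (λ j → F (n ∸ i) * G j) (m∸[m∸n]≡n i≤n)) (*-comm (F (n ∸ i)) (G i))))

⋆-distribʳ-+ : ∀ F F′ G n → ((λ i → F i + F′ i) ⋆ G) n ≡ (F ⋆ G) n + (F′ ⋆ G) n
⋆-distribʳ-+ F F′ G n = trans (sumTo-cong n (λ i _ → *-distribʳ-+ (G (n ∸ i)) (F i) (F′ i))) (sumTo-+ n _ _)

⋆-*ˡ : ∀ k F G n → ((λ i → k * F i) ⋆ G) n ≡ k * (F ⋆ G) n
⋆-*ˡ k F G n = trans (sumTo-cong n (λ i _ → *-assoc k (F i) (G (n ∸ i)))) (sumTo-*ˡ n k _)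

δ-⋆ : ∀ a G n → G 0 ≡ 0 → (δ a ⋆ G) n ≡ G (n ∸ a)
δ-⋆ a G n G0≡0 with a ≤? n
... | yes a≤n = sumTo-δ n a (λ i → G (n ∸ i)) a≤n
... | no  a≰n = begin
  (δ a ⋆ G) n
    ≡⟨ sumTo-δ-> n a (λ i → G (n ∸ i)) (≰⇒> a≰n) ⟩
  0
    ≡⟨ sym G0≡0 ⟩
  G 0
    ≡⟨ cong G (sym (m≤n⇒m∸n≡0 (<⇒≤ (≰⇒> a≰n)))) ⟩
  G (n ∸ a) ∎
  where open ≡-Reasoning

⋆-shiftˡ : ∀ s F G n → F 0 ≡ 0 → ((λ i → F (i ∸ s)) ⋆ G) n ≡ (F ⋆ G) (n ∸ s)
⋆-shiftˡ zero    F G n       _     = refl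
⋆-shiftˡ (suc s) F G zero    _     = refl
⋆-shiftˡ (suc s) F G (suc n) F0≡0 rewrite F0≡0 = ⋆-shiftˡ s F G n F0≡0

⋆-below : ∀ (c X Y : ℕ → ℕ) n → c 0 ≡ 0 → (∀ i → i < n → X i ≡ Y i) → (X ⋆ c) n ≡ (Y ⋆ c) n
⋆-below c X Y n c0≡0 X≡Y = sumTo-cong n agree
  where
  agree : ∀ i → i ≤ n → X i * c (n ∸ i) ≡ Y i * c (n ∸ i)
  agree i i≤n with m≤n⇒m<n∨m≡n i≤n
  ... | inj₁ i<n  = cong (_* c (n ∸ i)) (X≡Y i i<n)
  ... | inj₂ refl rewrite n∸n≡0 i | c0≡0 = trans (*-zeroʳ (X i)) (sym (*-zeroʳ (Y i)))

recurrence-unique : ∀ (c h X Y : ℕ → ℕ) → c 0 ≡ 0 →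
  (∀ n → X n ≡ h n + (X ⋆ c) n + (c ⋆ X) n) →
  (∀ n → Y n ≡ h n + (Y ⋆ c) n + (c ⋆ Y) n) →
  ∀ n → X n ≡ Y n
recurrence-unique c h X Y c0≡0 X-rec Y-rec = <-rec (λ n → X n ≡ Y n) step
  where
  step : ∀ n → (∀ {i} → i < n → X i ≡ Y i) → X n ≡ Y n
  step n X≡Y = begin
    X n
      ≡⟨ X-rec n ⟩
    h n + (X ⋆ c) n + (c ⋆ X) n
      ≡⟨ cong₂ (λ x y → h n + x + y) below (trans (⋆-comm c X n) (trans below (⋆-comm Y c n))) ⟩
    h n + (Y ⋆ c) n + (c ⋆ Y) n
      ≡⟨ sym (Y-rec n) ⟩
    Y n ∎
    where
    open ≡-Reasoning
    below : (X ⋆ c) n ≡ (Y ⋆ c) n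
    below = ⋆-below c X Y n c0≡0 (λ i → X≡Y)

recurrence-scale-shift : ∀ (c h X : ℕ → ℕ) k s → X 0 ≡ 0 →
  (∀ n → X n ≡ h n + (X ⋆ c) n + (c ⋆ X) n) →
  ∀ n → k * X (n ∸ s) ≡ k * h (n ∸ s) + ((λ i → k * X (i ∸ s)) ⋆ c) n + (c ⋆ (λ i → k * X (i ∸ s))) n
recurrence-scale-shift c h X k s X0≡0 X-rec n = begin
  k * X m
    ≡⟨ cong (k *_) (X-rec m) ⟩
  k * (h m + (X ⋆ c) m + (c ⋆ X) m)
    ≡⟨ cong (λ x → k * (h m + (X ⋆ c) m + x)) (⋆-comm c X m) ⟩
  k * (h m + (X ⋆ c) m + (X ⋆ c) m)
    ≡⟨ distrib k (h m) ((X ⋆ c) m) ⟩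
  k * h m + k * (X ⋆ c) m + k * (X ⋆ c) m
    ≡⟨ cong₂ (λ x y → k * h m + x + y) shifted (trans shifted (⋆-comm Xks c n)) ⟩
  k * h m + (Xks ⋆ c) n + (c ⋆ Xks) n ∎
  where
  open ≡-Reasoning
  m = n ∸ s
  Xks : ℕ → ℕ
  Xks i = k * X (i ∸ s)
  distrib : ∀ k x y → k * (x + y + y) ≡ k * x + k * y + k * y
  distrib = solve-∀
  shifted : k * (X ⋆ c) m ≡ (Xks ⋆ c) n
  shifted = sym (trans (⋆-*ˡ k (λ i → X (i ∸ s)) c n) (cong (k *_) (⋆-shiftˡ s X c n X0≡0)))

-- Sums over the trees with n leaves

leaves-pos : ∀ t → leaves t ≡ suc (leaves t ∸ 1)
leaves-pos leaf       = refl
leaves-pos (node l r) rewrite leaves-pos l = refl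

treeSum : (Tree → ℕ) → ℕ → ℕ
treeSum w n = ∑ (trees n) w

treeSum≤ : ℕ → (Tree → ℕ) → ℕ → ℕ
treeSum≤ d w n = ∑ (treesUpTo d) (λ t → δ (leaves t) n * w t)

splitSum≤ : ℕ → (Tree → Tree → ℕ) → ℕ → ℕ → ℕ
splitSum≤ d u i j = treeSum≤ d (λ l → treeSum≤ d (u l) j) i

treeSum≡treeSum≤ : ∀ w n → treeSum w n ≡ treeSum≤ n w n
treeSum≡treeSum≤ w n = ∑-filter-≟ leaves n (treesUpTo n) w

treeSum≤-zero : ∀ d w → treeSum≤ d w 0 ≡ 0
treeSum≤-zero d w = trans (∑-cong (treesUpTo d) (λ t → cong (λ k → δ k 0 * w t) (leaves-pos t)))
                          (∑-zero (treesUpTo d))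

splitSum≤-zeroˡ : ∀ d u j → splitSum≤ d u 0 j ≡ 0
splitSum≤-zeroˡ d u j = treeSum≤-zero d _

splitSum≤-zeroʳ : ∀ d u i → splitSum≤ d u i 0 ≡ 0
splitSum≤-zeroʳ d u i = trans (∑-cong (treesUpTo d) (λ l → cong (δ (leaves l) i *_) (treeSum≤-zero d (u l))))
  (trans (∑-cong (treesUpTo d) (λ l → *-zeroʳ (δ (leaves l) i))) (∑-zero (treesUpTo d)))

treeSum≤-suc : ∀ d w n → treeSum≤ (suc d) w n ≡
  δ 1 n * w leaf + sumTo n (λ i → splitSum≤ d (λ l r → w (node l r)) i (n ∸ i))
treeSum≤-suc d w n = cong (δ 1 n * w leaf +_) (begin
  ∑ (concatMap (λ l → map (node l) ts) ts) (λ t → δ (leaves t) n * w t)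
    ≡⟨ ∑-concatMap (λ l → map (node l) ts) ts _ ⟩
  ∑ ts (λ l → ∑ (map (node l) ts) (λ t → δ (leaves t) n * w t))
    ≡⟨ ∑-cong ts (λ l → trans (∑-map (node l) ts _) (∑-cong ts (λ r → cong (_* w (node l r)) (split l r)))) ⟩
  ∑ ts (λ l → H l (n ∸ leaves l))
    ≡⟨ ∑-cong ts (λ l → sym (δ-⋆ (leaves l) (H l) n (treeSum≤-zero d _))) ⟩
  ∑ ts (λ l → sumTo n (λ i → δ (leaves l) i * H l (n ∸ i)))
    ≡⟨ ∑-sumTo ts n (λ l i → δ (leaves l) i * H l (n ∸ i)) ⟩
  sumTo n (λ i → splitSum≤ d (λ l r → w (node l r)) i (n ∸ i)) ∎)
  where
  open ≡-Reasoning
  ts = treesUpTo d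
  H : Tree → ℕ → ℕ
  H l = treeSum≤ d (λ r → w (node l r))
  split : ∀ l r → δ (leaves l + leaves r) n ≡ δ (leaves r) (n ∸ leaves l)
  split l r rewrite leaves-pos r = δ-∸ (leaves l) (leaves r ∸ 1) n

treeSum≤-step : ∀ d w n → n ≤ suc d → treeSum≤ d w n ≡ treeSum≤ (suc d) w n
treeSum≤-step zero w n n≤1 = begin
  δ 1 n * w leaf + 0
    ≡⟨ cong (δ 1 n * w leaf +_) (sym (trans (sumTo-cong n vanish) (sumTo-zero n))) ⟩
  δ 1 n * w leaf + sumTo n (λ i → splitSum≤ 0 u i (n ∸ i))
    ≡⟨ sym (treeSum≤-suc 0 w n) ⟩
  treeSum≤ 1 w n ∎
  where
  open ≡-Reasoning
  u : Tree → Tree → ℕ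
  u l r = w (node l r)
  vanish : ∀ i → i ≤ n → splitSum≤ 0 u i (n ∸ i) ≡ 0
  vanish zero    _ = splitSum≤-zeroˡ 0 u n
  vanish (suc i) _ = trans (cong (splitSum≤ 0 u (suc i)) (m≤n⇒m∸n≡0 (≤-trans n≤1 (s≤s z≤n))))
                           (splitSum≤-zeroʳ 0 u (suc i))
treeSum≤-step (suc e) w n n≤ = begin
  treeSum≤ (suc e) w n
    ≡⟨ treeSum≤-suc e w n ⟩
  δ 1 n * w leaf + sumTo n (λ i → splitSum≤ e u i (n ∸ i))
    ≡⟨ cong (δ 1 n * w leaf +_) (sumTo-cong n (λ i i≤n → term i (n ∸ i) (i+[n∸i]≤ i≤n))) ⟩
  δ 1 n * w leaf + sumTo n (λ i → splitSum≤ (suc e) u i (n ∸ i))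
    ≡⟨ sym (treeSum≤-suc (suc e) w n) ⟩
  treeSum≤ (suc (suc e)) w n ∎
  where
  open ≡-Reasoning
  u : Tree → Tree → ℕ
  u l r = w (node l r)
  i+[n∸i]≤ : ∀ {i} → i ≤ n → i + (n ∸ i) ≤ suc (suc e)
  i+[n∸i]≤ i≤n = subst (_≤ suc (suc e)) (sym (m+[n∸m]≡n i≤n)) n≤
  term : ∀ i j → i + j ≤ suc (suc e) → splitSum≤ e u i j ≡ splitSum≤ (suc e) u i j
  term zero    j       _ = trans (splitSum≤-zeroˡ e u j) (sym (splitSum≤-zeroˡ (suc e) u j))
  term (suc i) zero    _ = trans (splitSum≤-zeroʳ e u (suc i)) (sym (splitSum≤-zeroʳ (suc e) u (suc i)))
  term (suc i) (suc j) (s≤s i+j<) = trans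
    (∑-cong (treesUpTo e) (λ l → cong (δ (leaves l) (suc i) *_) (treeSum≤-step e (u l) (suc j) j<)))
    (treeSum≤-step e _ (suc i) i<)
    where
    i< : suc i ≤ suc e
    i< = s≤s (≤-trans (m≤m+n i j) (≤-pred (subst (_≤ suc e) (+-suc i j) i+j<)))
    j< : suc j ≤ suc e
    j< = ≤-trans (m≤n+m (suc j) i) i+j<

treeSum≤-mono : ∀ k d w n → n ≤ suc d → treeSum≤ d w n ≡ treeSum≤ (k + d) w n
treeSum≤-mono zero    d w n _   = refl
treeSum≤-mono (suc k) d w n n≤ =
  trans (treeSum≤-mono k d w n n≤) (treeSum≤-step (k + d) w n (≤-trans n≤ (s≤s (m≤n+m d k))))

treeSum≤-stable : ∀ d w n → n ≤ suc d → treeSum≤ d w n ≡ treeSum w n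
treeSum≤-stable d w n n≤ with ≤-total d n
... | inj₁ d≤n = begin
  treeSum≤ d w n             ≡⟨ treeSum≤-mono (n ∸ d) d w n n≤ ⟩
  treeSum≤ (n ∸ d + d) w n   ≡⟨ cong (λ e → treeSum≤ e w n) (m∸n+n≡m d≤n) ⟩
  treeSum≤ n w n             ≡⟨ sym (treeSum≡treeSum≤ w n) ⟩
  treeSum w n                ∎
  where open ≡-Reasoning
... | inj₂ n≤d = begin
  treeSum≤ d w n             ≡⟨ cong (λ e → treeSum≤ e w n) (sym (m∸n+n≡m n≤d)) ⟩
  treeSum≤ (d ∸ n + n) w n   ≡⟨ sym (treeSum≤-mono (d ∸ n) n w n (n≤1+n n)) ⟩
  treeSum≤ n w n             ≡⟨ sym (treeSum≡treeSum≤ w n) ⟩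
  treeSum w n                ∎
  where open ≡-Reasoning

treeCount : ℕ → ℕ
treeCount = treeSum (λ _ → 1)

pairSum : (Tree → Tree → ℕ) → ℕ → ℕ
pairSum u n = sumTo n (λ i → treeSum (λ l → treeSum (u l) (n ∸ i)) i)

treeSum-decomposition : ∀ w n → treeSum w n ≡ δ 1 n * w leaf + pairSum (λ l r → w (node l r)) n
treeSum-decomposition w n = begin
  treeSum w n
    ≡⟨ sym (treeSum≤-stable (suc n) w n (m≤n+m n 2)) ⟩
  treeSum≤ (suc n) w n
    ≡⟨ treeSum≤-suc n w n ⟩
  δ 1 n * w leaf + sumTo n (λ i → splitSum≤ n u i (n ∸ i))
    ≡⟨ cong (δ 1 n * w leaf +_) (sumTo-cong n stable) ⟩
  δ 1 n * w leaf + pairSum u n ∎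
  where
  open ≡-Reasoning
  u : Tree → Tree → ℕ
  u l r = w (node l r)
  stable : ∀ i → i ≤ n → splitSum≤ n u i (n ∸ i) ≡ treeSum (λ l → treeSum (u l) (n ∸ i)) i
  stable i i≤n = trans
    (∑-cong (treesUpTo n) (λ l → cong (δ (leaves l) i *_) (treeSum≤-stable n (u l) (n ∸ i) n∸i≤)))
    (treeSum≤-stable n _ i (≤-trans i≤n (n≤1+n n)))
    where
    n∸i≤ : n ∸ i ≤ suc n
    n∸i≤ = ≤-trans (m∸n≤m n i) (n≤1+n n)

treeSum-leaves : ∀ (h : ℕ → ℕ) w n → treeSum (λ t → h (leaves t) * w t) n ≡ h n * treeSum w n
treeSum-leaves h w n = begin
  treeSum (λ t → h (leaves t) * w t) n
    ≡⟨ treeSum≡treeSum≤ _ n ⟩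
  ∑ (treesUpTo n) (λ t → δ (leaves t) n * (h (leaves t) * w t))
    ≡⟨ ∑-cong (treesUpTo n) pick ⟩
  ∑ (treesUpTo n) (λ t → h n * (δ (leaves t) n * w t))
    ≡⟨ ∑-*ˡ (treesUpTo n) (h n) _ ⟩
  h n * treeSum≤ n w n
    ≡⟨ cong (h n *_) (sym (treeSum≡treeSum≤ w n)) ⟩
  h n * treeSum w n ∎
  where
  open ≡-Reasoning
  pick : ∀ t → δ (leaves t) n * (h (leaves t) * w t) ≡ h n * (δ (leaves t) n * w t)
  pick t = trans (δ-*-subst (leaves t) n (λ k → h k * w t)) (*-left-comm (δ (leaves t) n) (h n) (w t))

pairSum-cong : ∀ {u v : Tree → Tree → ℕ} → (∀ l r → u l r ≡ v l r) → ∀ n → pairSum u n ≡ pairSum v n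
pairSum-cong u≗v n = sumTo-cong n (λ i _ → ∑-cong (trees i) (λ l → ∑-cong (trees (n ∸ i)) (u≗v l)))

pairSum-+ : ∀ (u v : Tree → Tree → ℕ) n → pairSum (λ l r → u l r + v l r) n ≡ pairSum u n + pairSum v n
pairSum-+ u v n = trans
  (sumTo-cong n (λ i _ → trans (∑-cong (trees i) (λ l → ∑-+ (trees (n ∸ i)) (u l) (v l))) (∑-+ (trees i) _ _)))
  (sumTo-+ n _ _)

pairSum-* : ∀ (f g : Tree → ℕ) n → pairSum (λ l r → f l * g r) n ≡ (treeSum f ⋆ treeSum g) n
pairSum-* f g n = sumTo-cong n (λ i _ → trans
  (∑-cong (trees i) (λ l → trans (∑-*ˡ (trees (n ∸ i)) (f l) g) (*-comm (f l) _)))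
  (trans (∑-*ˡ (trees i) (treeSum g (n ∸ i)) f) (*-comm (treeSum g (n ∸ i)) _)))

pairSum-zero : ∀ n → pairSum (λ _ _ → 0) n ≡ 0
pairSum-zero n = trans
  (sumTo-cong n (λ i _ → trans (∑-cong (trees i) (λ _ → ∑-zero (trees (n ∸ i)))) (∑-zero (trees i))))
  (sumTo-zero n)

treeSum-additive : ∀ w h → (∀ l r → w (node l r) ≡ h l r + w l + w r) → ∀ n →
  treeSum w n ≡ δ 1 n * w leaf + pairSum h n + (treeSum w ⋆ treeCount) n + (treeCount ⋆ treeSum w) n
treeSum-additive w h w-node n = begin
  treeSum w n
    ≡⟨ treeSum-decomposition w n ⟩
  δ 1 n * w leaf + pairSum (λ l r → w (node l r)) n
    ≡⟨ cong (δ 1 n * w leaf +_) (pairSum-cong node≡ n) ⟩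
  δ 1 n * w leaf + pairSum (λ l r → h l r + w l * 1 + 1 * w r) n
    ≡⟨ cong (δ 1 n * w leaf +_) (pairSum-+ (λ l r → h l r + w l * 1) (λ l r → 1 * w r) n) ⟩
  δ 1 n * w leaf + (pairSum (λ l r → h l r + w l * 1) n + pairSum (λ l r → 1 * w r) n)
    ≡⟨ cong (λ x → δ 1 n * w leaf + (x + pairSum (λ l r → 1 * w r) n)) (pairSum-+ h (λ l r → w l * 1) n) ⟩
  δ 1 n * w leaf + (pairSum h n + pairSum (λ l r → w l * 1) n + pairSum (λ l r → 1 * w r) n)
    ≡⟨ cong₂ (λ x y → δ 1 n * w leaf + (pairSum h n + x + y)) (pairSum-* w (λ _ → 1) n) (pairSum-* (λ _ → 1) w n) ⟩
  δ 1 n * w leaf + (pairSum h n + (treeSum w ⋆ treeCount) n + (treeCount ⋆ treeSum w) n)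
    ≡⟨ +-assoc-4 (δ 1 n * w leaf) (pairSum h n) _ _ ⟩
  δ 1 n * w leaf + pairSum h n + (treeSum w ⋆ treeCount) n + (treeCount ⋆ treeSum w) n ∎
  where
  open ≡-Reasoning
  +-assoc-4 : ∀ a x y z → a + (x + y + z) ≡ a + x + y + z
  +-assoc-4 = solve-∀
  node≡ : ∀ l r → w (node l r) ≡ h l r + w l * 1 + 1 * w r
  node≡ l r = trans (w-node l r) (cong₂ (λ x y → h l r + x + y) (sym (*-identityʳ (w l))) (sym (*-identityˡ (w r))))

-- Counting trees, leaves, vertices and marked vertices

treeCount-rec : ∀ n → treeCount n ≡ δ 1 n + (treeCount ⋆ treeCount) n
treeCount-rec n = trans (treeSum-decomposition (λ _ → 1) n)
  (cong₂ _+_ (*-identityʳ (δ 1 n)) (pairSum-* (λ _ → 1) (λ _ → 1) n))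

leafSum : ℕ → ℕ
leafSum = treeSum leaves

leafSum-closed : ∀ n → leafSum n ≡ n * treeCount n
leafSum-closed n = trans (∑-cong (trees n) (λ t → sym (*-identityʳ (leaves t))))
                         (treeSum-leaves (λ k → k) (λ _ → 1) n)

leafSum-rec : ∀ n → leafSum n ≡ δ 1 n + (leafSum ⋆ treeCount) n + (treeCount ⋆ leafSum) n
leafSum-rec n = trans (treeSum-additive leaves (λ _ _ → 0) (λ l r → refl) n)
  (cong (λ x → x + (leafSum ⋆ treeCount) n + (treeCount ⋆ leafSum) n)
        (trans (cong₂ _+_ (*-identityʳ (δ 1 n)) (pairSum-zero n)) (+-identityʳ (δ 1 n))))

vertices : Tree → ℕ
vertices leaf       = 1
vertices (node l r) = 1 + vertices l + vertices r

vertexSum : ℕ → ℕ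
vertexSum = treeSum vertices

vertices-leaves : ∀ t → vertices t + 1 ≡ 2 * leaves t
vertices-leaves leaf       = refl
vertices-leaves (node l r) = begin
  1 + vertices l + vertices r + 1     ≡⟨ regroup (vertices l) (vertices r) ⟩
  (vertices l + 1) + (vertices r + 1) ≡⟨ cong₂ _+_ (vertices-leaves l) (vertices-leaves r) ⟩
  2 * leaves l + 2 * leaves r         ≡⟨ sym (*-distribˡ-+ 2 (leaves l) (leaves r)) ⟩
  2 * (leaves l + leaves r)           ∎
  where
  open ≡-Reasoning
  regroup : ∀ x y → 1 + x + y + 1 ≡ (x + 1) + (y + 1)
  regroup = solve-∀

vertexSum-closed : ∀ n → vertexSum n + treeCount n ≡ 2 * n * treeCount n
vertexSum-closed n = begin
  vertexSum n + treeCount n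
    ≡⟨ sym (∑-+ (trees n) vertices (λ _ → 1)) ⟩
  treeSum (λ t → vertices t + 1) n
    ≡⟨ ∑-cong (trees n) (λ t → trans (vertices-leaves t) (sym (*-identityʳ _))) ⟩
  treeSum (λ t → 2 * leaves t * 1) n
    ≡⟨ treeSum-leaves (2 *_) (λ _ → 1) n ⟩
  2 * n * treeCount n ∎
  where open ≡-Reasoning

vertexSum-rec : ∀ n → vertexSum n ≡ treeCount n + (vertexSum ⋆ treeCount) n + (treeCount ⋆ vertexSum) n
vertexSum-rec n = trans (treeSum-additive vertices (λ _ _ → 1) (λ l r → refl) n)
  (cong (λ x → x + (vertexSum ⋆ treeCount) n + (treeCount ⋆ vertexSum) n)
        (trans (cong₂ _+_ (*-identityʳ (δ 1 n)) (pairSum-* (λ _ → 1) (λ _ → 1) n)) (sym (treeCount-rec n))))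

-- R is the count predicted by Rémy's bijection: a tree with n leaves and a marked leaf arises from a
-- tree with n − 1 leaves, one of its 2n − 3 vertices and a side.
remy : ∀ n → leafSum n ≡ δ 1 n + 2 * vertexSum (n ∸ 1)
remy = recurrence-unique treeCount (δ 1) leafSum R refl leafSum-rec R-rec
  where
  R : ℕ → ℕ
  R n = δ 1 n + 2 * vertexSum (n ∸ 1)
  R⋆c : ∀ n → (R ⋆ treeCount) n ≡ treeCount (n ∸ 1) + 2 * (vertexSum ⋆ treeCount) (n ∸ 1)
  R⋆c n = begin
    (R ⋆ treeCount) n
      ≡⟨ ⋆-distribʳ-+ (δ 1) (λ i → 2 * vertexSum (i ∸ 1)) treeCount n ⟩
    (δ 1 ⋆ treeCount) n + ((λ i → 2 * vertexSum (i ∸ 1)) ⋆ treeCount) n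
      ≡⟨ cong₂ _+_ (δ-⋆ 1 treeCount n refl) (⋆-*ˡ 2 (λ i → vertexSum (i ∸ 1)) treeCount n) ⟩
    treeCount (n ∸ 1) + 2 * ((λ i → vertexSum (i ∸ 1)) ⋆ treeCount) n
      ≡⟨ cong (λ x → treeCount (n ∸ 1) + 2 * x) (⋆-shiftˡ 1 vertexSum treeCount n refl) ⟩
    treeCount (n ∸ 1) + 2 * (vertexSum ⋆ treeCount) (n ∸ 1) ∎
    where open ≡-Reasoning
  R-rec : ∀ n → R n ≡ δ 1 n + (R ⋆ treeCount) n + (treeCount ⋆ R) n
  R-rec n = sym (begin
    δ 1 n + (R ⋆ treeCount) n + (treeCount ⋆ R) n
      ≡⟨ cong (δ 1 n + (R ⋆ treeCount) n +_) (⋆-comm treeCount R n) ⟩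
    δ 1 n + (R ⋆ treeCount) n + (R ⋆ treeCount) n
      ≡⟨ cong (λ x → δ 1 n + x + x) (R⋆c n) ⟩
    δ 1 n + (c + 2 * v) + (c + 2 * v)
      ≡⟨ regroup (δ 1 n) c v ⟩
    δ 1 n + 2 * (c + v + v)
      ≡⟨ cong (λ x → δ 1 n + 2 * (c + v + x)) (⋆-comm vertexSum treeCount (n ∸ 1)) ⟩
    δ 1 n + 2 * (c + v + (treeCount ⋆ vertexSum) (n ∸ 1))
      ≡⟨ cong (λ x → δ 1 n + 2 * x) (sym (vertexSum-rec (n ∸ 1))) ⟩
    R n ∎)
    where
    open ≡-Reasoning
    c = treeCount (n ∸ 1)
    v = (vertexSum ⋆ treeCount) (n ∸ 1)
    regroup : ∀ d c v → d + (c + 2 * v) + (c + 2 * v) ≡ d + 2 * (c + v + v)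
    regroup = solve-∀

treeCount-remy : ∀ k → (2 + k) * treeCount (2 + k) ≡ 2 * (2 * k + 1) * treeCount (suc k)
treeCount-remy k = +-cancelʳ-≡ (2 * c) _ _ (begin
  (2 + k) * treeCount (2 + k) + 2 * c
    ≡⟨ cong (_+ 2 * c) (trans (sym (leafSum-closed (2 + k))) (remy (2 + k))) ⟩
  2 * vertexSum (suc k) + 2 * c
    ≡⟨ sym (*-distribˡ-+ 2 (vertexSum (suc k)) c) ⟩
  2 * (vertexSum (suc k) + c)
    ≡⟨ cong (2 *_) (vertexSum-closed (suc k)) ⟩
  2 * (2 * suc k * c)
    ≡⟨ regroup k c ⟩
  2 * (2 * k + 1) * c + 2 * c ∎)
  where
  open ≡-Reasoning
  c = treeCount (suc k)
  regroup : ∀ k c → 2 * (2 * suc k * c) ≡ 2 * (2 * k + 1) * c + 2 * c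
  regroup = solve-∀

treeCount-nonZero : ∀ j → NonZero (treeCount (suc j))
treeCount-nonZero zero    = _
treeCount-nonZero (suc j) = m*n≢0⇒n≢0 (2 + j) {{subst NonZero (sym (treeCount-remy j)) nonZero-rhs}}
  where
  instance
    odd : NonZero (2 * j + 1)
    odd = subst NonZero (+-comm 1 (2 * j)) _
    ih : NonZero (treeCount (suc j))
    ih = treeCount-nonZero j
  nonZero-rhs : NonZero (2 * (2 * j + 1) * treeCount (suc j))
  nonZero-rhs = m*n≢0 (2 * (2 * j + 1)) (treeCount (suc j)) {{m*n≢0 2 (2 * j + 1)}}

pairCount : ℕ → ℕ → Tree → ℕ
pairCount a b t = length (filter (λ p → (proj₁ p ≟ a) ×-dec (proj₂ p ≟ b)) (internalLR t))

pairCount-node : ∀ a b l r →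
  pairCount a b (node l r) ≡ δ (leaves l) a * δ (leaves r) b + pairCount a b l + pairCount a b r
pairCount-node a b l r with leaves l ≡ᵇ a | leaves r ≡ᵇ b
... | true  | true  = cong suc (length-filter-++ _ (internalLR l) (internalLR r))
... | true  | false = length-filter-++ _ (internalLR l) (internalLR r)
... | false | true  = length-filter-++ _ (internalLR l) (internalLR r)
... | false | false = length-filter-++ _ (internalLR l) (internalLR r)

markedCount : ℕ → ℕ → ℕ → ℕ
markedCount a b = treeSum (pairCount a b)

treeSum-δ-leaves : ∀ a n → treeSum (λ t → δ (leaves t) a) n ≡ treeCount a * δ a n
treeSum-δ-leaves a n = begin
  treeSum (λ t → δ (leaves t) a) n
    ≡⟨ ∑-cong (trees n) (λ t → sym (*-identityʳ _)) ⟩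
  treeSum (λ t → δ (leaves t) a * 1) n
    ≡⟨ treeSum-leaves (λ k → δ k a) (λ _ → 1) n ⟩
  δ n a * treeCount n
    ≡⟨ δ-*-subst n a treeCount ⟩
  δ n a * treeCount a
    ≡⟨ cong₂ _*_ (δ-sym n a) refl ⟩
  δ a n * treeCount a
    ≡⟨ *-comm (δ a n) _ ⟩
  treeCount a * δ a n ∎
  where open ≡-Reasoning

markedCount-rec : ∀ a b n → markedCount a b n ≡
  ((λ i → treeCount a * δ a i) ⋆ (λ j → treeCount b * δ b j)) n
    + (markedCount a b ⋆ treeCount) n + (treeCount ⋆ markedCount a b) n
markedCount-rec a b n = begin
  markedCount a b n
    ≡⟨ treeSum-additive (pairCount a b) (λ l r → δ (leaves l) a * δ (leaves r) b) (pairCount-node a b) n ⟩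
  δ 1 n * 0 + pairSum (λ l r → δ (leaves l) a * δ (leaves r) b) n + K⋆c + c⋆K
    ≡⟨ cong (λ x → x + K⋆c + c⋆K) (cong₂ _+_ (*-zeroʳ (δ 1 n)) (pairSum-* (δ-leaves a) (δ-leaves b) n)) ⟩
  (treeSum (δ-leaves a) ⋆ treeSum (δ-leaves b)) n + K⋆c + c⋆K
    ≡⟨ cong (λ x → x + K⋆c + c⋆K) (⋆-cong (treeSum-δ-leaves a) (treeSum-δ-leaves b) n) ⟩
  ((λ i → treeCount a * δ a i) ⋆ (λ j → treeCount b * δ b j)) n + K⋆c + c⋆K ∎
  where
  open ≡-Reasoning
  δ-leaves : ℕ → Tree → ℕ
  δ-leaves c t = δ (leaves t) c
  K⋆c = (markedCount a b ⋆ treeCount) n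
  c⋆K = (treeCount ⋆ markedCount a b) n

-- Cutting off the subtree at the marked vertex leaves a tree with n − a − b + 1 leaves and a marked
-- leaf; the recurrence confirms this count.
markedCount-closed : ∀ a b n → markedCount a (suc b) n ≡ treeCount a * treeCount (suc b) * leafSum (n ∸ (a + b))
markedCount-closed a b n = recurrence-unique treeCount h (markedCount a (suc b)) K refl
  (λ n → trans (markedCount-rec a (suc b) n)
     (cong (λ x → x + (markedCount a (suc b) ⋆ treeCount) n + (treeCount ⋆ markedCount a (suc b)) n) (points n)))
  (recurrence-scale-shift treeCount (δ 1) leafSum cc (a + b) refl leafSum-rec)
  n
  where
  cc = treeCount a * treeCount (suc b)
  h K : ℕ → ℕ
  h n = cc * δ 1 (n ∸ (a + b))
  K n = cc * leafSum (n ∸ (a + b))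
  Cb : ℕ → ℕ
  Cb j = treeCount (suc b) * δ (suc b) j
  points : ∀ n → ((λ i → treeCount a * δ a i) ⋆ Cb) n ≡ h n
  points n = begin
    ((λ i → treeCount a * δ a i) ⋆ Cb) n
      ≡⟨ ⋆-*ˡ (treeCount a) (δ a) Cb n ⟩
    treeCount a * (δ a ⋆ Cb) n
      ≡⟨ cong (treeCount a *_) (δ-⋆ a Cb n (*-zeroʳ (treeCount (suc b)))) ⟩
    treeCount a * (treeCount (suc b) * δ (suc b) (n ∸ a))
      ≡⟨ sym (*-assoc (treeCount a) _ _) ⟩
    cc * δ (suc b) (n ∸ a)
      ≡⟨ cong (cc *_) (trans (δ-suc-∸ (n ∸ a) b) (cong (δ 1) (∸-+-assoc n a b))) ⟩
    h n ∎
    where open ≡-Reasoning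

markedTotal : ℕ → ℕ
markedTotal n = (n ∸ 1) * treeCount n

markedTotal-nonZero : ∀ m → NonZero (markedTotal (2 + m))
markedTotal-nonZero m = m*n≢0 (suc m) (treeCount (2 + m)) {{_}} {{treeCount-nonZero (suc m)}}

internalLR-length : ∀ t → length (internalLR t) ≡ leaves t ∸ 1
internalLR-length leaf       = refl
internalLR-length (node l r) = begin
  suc (length (internalLR l ++ internalLR r))
    ≡⟨ cong suc (length-++ (internalLR l)) ⟩
  suc (length (internalLR l) + length (internalLR r))
    ≡⟨ cong₂ (λ x y → suc (x + y)) (internalLR-length l) (internalLR-length r) ⟩
  suc ((leaves l ∸ 1) + (leaves r ∸ 1))
    ≡⟨ sym (+-suc _ _) ⟩
  (leaves l ∸ 1) + suc (leaves r ∸ 1)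
    ≡⟨ cong ((leaves l ∸ 1) +_) (sym (leaves-pos r)) ⟩
  (leaves l ∸ 1) + leaves r
    ≡⟨ sym (+-∸-comm (leaves r) (subst (1 ≤_) (sym (leaves-pos l)) (s≤s z≤n))) ⟩
  leaves l + leaves r ∸ 1 ∎
  where open ≡-Reasoning

markedLR-length : ∀ n → length (markedLR n) ≡ markedTotal n
markedLR-length n = begin
  length (markedLR n)
    ≡⟨ length-concatMap internalLR (trees n) ⟩
  treeSum (λ t → length (internalLR t)) n
    ≡⟨ ∑-cong (trees n) (λ t → trans (internalLR-length t) (sym (*-identityʳ _))) ⟩
  treeSum (λ t → (leaves t ∸ 1) * 1) n
    ≡⟨ treeSum-leaves (_∸ 1) (λ _ → 1) n ⟩
  (n ∸ 1) * treeCount n ∎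
  where open ≡-Reasoning

markedLR-pairCount : ∀ a b n →
  length (filter (λ p → (proj₁ p ≟ a) ×-dec (proj₂ p ≟ b)) (markedLR n)) ≡ markedCount a b n
markedLR-pairCount a b n = length-filter-concatMap _ internalLR (trees n)

-- Central binomial coefficients and Wallis-type bounds

-- The central binomial coefficient binom(2j, j).  Opaque, since otherwise numeric instances such as
-- central 6 ≡ 924 get checked by enumerating all trees of height ≤ 7.
opaque
  central : ℕ → ℕ
  central j = suc j * treeCount (suc j)

  central-unfold : ∀ j → central j ≡ suc j * treeCount (suc j)
  central-unfold j = refl

central-rec : ∀ j → suc j * central (suc j) ≡ 2 * (2 * j + 1) * central j
central-rec j = begin
  suc j * central (suc j)
    ≡⟨ cong (suc j *_) (trans (central-unfold (suc j)) (treeCount-remy j)) ⟩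
  suc j * (2 * (2 * j + 1) * treeCount (suc j))
    ≡⟨ *-left-comm (suc j) (2 * (2 * j + 1)) (treeCount (suc j)) ⟩
  2 * (2 * j + 1) * (suc j * treeCount (suc j))
    ≡⟨ cong (2 * (2 * j + 1) *_) (sym (central-unfold j)) ⟩
  2 * (2 * j + 1) * central j ∎
  where open ≡-Reasoning

central-next : ∀ j {v} w → central j ≡ v → suc j * w ≡ 2 * (2 * j + 1) * v → central (suc j) ≡ w
central-next j w refl eq = *-cancelˡ-≡ _ _ (suc j) (trans (central-rec j) (sym eq))

central-6 : central 6 ≡ 924
central-6 = central-next 5 924 (central-next 4 252 (central-next 3 70 (central-next 2 20
              (central-next 1 6 (central-next 0 2 (central-unfold 0) refl) refl) refl) refl) refl) refl

-- wallisLower j / 16^j increases and wallisUpper j / 16^j decreases, both to 4/π (Wallis).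
wallisLower wallisUpper : ℕ → ℕ
wallisLower j = central j * central j * (4 * j + 1)
wallisUpper j = 2 * (central j * central j * (2 * j + 1))

wallisLower-step : ∀ j → 16 * wallisLower j ≤ wallisLower (suc j)
wallisLower-step j = *-cancelˡ-≤ (suc j * suc j) (begin
  suc j * suc j * (16 * (cj * cj * (4 * j + 1)))
    ≤⟨ m≤m+n _ (4 * cj * cj) ⟩
  suc j * suc j * (16 * (cj * cj * (4 * j + 1))) + 4 * cj * cj
    ≡⟨ expand j cj ⟩
  (2 * (2 * j + 1) * cj) * (2 * (2 * j + 1) * cj) * (4 * suc j + 1)
    ≡⟨ cong (λ x → x * x * (4 * suc j + 1)) (sym (central-rec j)) ⟩
  (suc j * central (suc j)) * (suc j * central (suc j)) * (4 * suc j + 1)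
    ≡⟨ regroup (suc j) (central (suc j)) (4 * suc j + 1) ⟩
  suc j * suc j * wallisLower (suc j) ∎)
  where
  open ≤-Reasoning
  cj = central j
  expand : ∀ j x → suc j * suc j * (16 * (x * x * (4 * j + 1))) + 4 * x * x
                 ≡ (2 * (2 * j + 1) * x) * (2 * (2 * j + 1) * x) * (4 * suc j + 1)
  expand = solve-∀
  regroup : ∀ x y z → (x * y) * (x * y) * z ≡ x * x * (y * y * z)
  regroup = solve-∀

wallisUpper-step : ∀ j → wallisUpper (suc j) ≤ 16 * wallisUpper j
wallisUpper-step j = *-cancelˡ-≤ (suc j * suc j) (begin
  suc j * suc j * wallisUpper (suc j)
    ≡⟨ regroup (suc j) (central (suc j)) (2 * suc j + 1) ⟩
  2 * ((suc j * central (suc j)) * (suc j * central (suc j)) * (2 * suc j + 1))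
    ≡⟨ cong (λ x → 2 * (x * x * (2 * suc j + 1))) (central-rec j) ⟩
  2 * ((2 * (2 * j + 1) * cj) * (2 * (2 * j + 1) * cj) * (2 * suc j + 1))
    ≤⟨ m≤m+n _ (8 * cj * cj * (2 * j + 1)) ⟩
  2 * ((2 * (2 * j + 1) * cj) * (2 * (2 * j + 1) * cj) * (2 * suc j + 1)) + 8 * cj * cj * (2 * j + 1)
    ≡⟨ expand j cj ⟩
  suc j * suc j * (16 * wallisUpper j) ∎)
  where
  open ≤-Reasoning
  cj = central j
  regroup : ∀ x y z → x * x * (2 * (y * y * z)) ≡ 2 * ((x * y) * (x * y) * z)
  regroup = solve-∀
  expand : ∀ j x → 2 * ((2 * (2 * j + 1) * x) * (2 * (2 * j + 1) * x) * (2 * suc j + 1)) + 8 * x * x * (2 * j + 1)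
                 ≡ suc j * suc j * (16 * (2 * (x * x * (2 * j + 1))))
  expand = solve-∀

wallisLower≤wallisUpper : ∀ j → wallisLower j ≤ wallisUpper j
wallisLower≤wallisUpper j = subst (wallisLower j ≤_) (double (central j) j) (m≤m+n (wallisLower j) (central j * central j))
  where
  double : ∀ B j → B * B * (4 * j + 1) + B * B ≡ 2 * (B * B * (2 * j + 1))
  double = solve-∀

wallisLower-mono : ∀ d i → wallisLower i * 16 ^ d ≤ wallisLower (d + i)
wallisLower-mono zero    i = ≤-reflexive (*-identityʳ (wallisLower i))
wallisLower-mono (suc d) i = begin
  wallisLower i * (16 * 16 ^ d)
    ≡⟨ *-left-comm (wallisLower i) 16 (16 ^ d) ⟩
  16 * (wallisLower i * 16 ^ d)
    ≤⟨ *-monoʳ-≤ 16 (wallisLower-mono d i) ⟩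
  16 * wallisLower (d + i)
    ≤⟨ wallisLower-step (d + i) ⟩
  wallisLower (suc d + i) ∎
  where open ≤-Reasoning

wallisUpper-mono : ∀ d j → wallisUpper (d + j) ≤ 16 ^ d * wallisUpper j
wallisUpper-mono zero    j = ≤-reflexive (sym (+-identityʳ (wallisUpper j)))
wallisUpper-mono (suc d) j = begin
  wallisUpper (suc d + j)
    ≤⟨ wallisUpper-step (d + j) ⟩
  16 * wallisUpper (d + j)
    ≤⟨ *-monoʳ-≤ 16 (wallisUpper-mono d j) ⟩
  16 * (16 ^ d * wallisUpper j)
    ≡⟨ sym (*-assoc 16 (16 ^ d) (wallisUpper j)) ⟩
  16 ^ suc d * wallisUpper j ∎
  where open ≤-Reasoning

wallis-sandwich : ∀ i j → wallisLower i * 16 ^ j ≤ wallisUpper j * 16 ^ i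
wallis-sandwich i j with ≤-total i j
... | inj₁ i≤j = subst (λ j → wallisLower i * 16 ^ j ≤ wallisUpper j * 16 ^ i) (m∸n+n≡m i≤j) (begin
  wallisLower i * 16 ^ (d + i)
    ≡⟨ cong (wallisLower i *_) (^-distribˡ-+-* 16 d i) ⟩
  wallisLower i * (16 ^ d * 16 ^ i)
    ≡⟨ sym (*-assoc (wallisLower i) _ _) ⟩
  wallisLower i * 16 ^ d * 16 ^ i
    ≤⟨ *-monoˡ-≤ (16 ^ i) (wallisLower-mono d i) ⟩
  wallisLower (d + i) * 16 ^ i
    ≤⟨ *-monoˡ-≤ (16 ^ i) (wallisLower≤wallisUpper (d + i)) ⟩
  wallisUpper (d + i) * 16 ^ i ∎)
  where
  open ≤-Reasoning
  d = j ∸ i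
... | inj₂ j≤i = subst (λ i → wallisLower i * 16 ^ j ≤ wallisUpper j * 16 ^ i) (m∸n+n≡m j≤i) (begin
  wallisLower (d + j) * 16 ^ j
    ≤⟨ *-monoˡ-≤ (16 ^ j) (wallisLower≤wallisUpper (d + j)) ⟩
  wallisUpper (d + j) * 16 ^ j
    ≤⟨ *-monoˡ-≤ (16 ^ j) (wallisUpper-mono d j) ⟩
  16 ^ d * wallisUpper j * 16 ^ j
    ≡⟨ trans (*-assoc (16 ^ d) _ _) (*-left-comm (16 ^ d) (wallisUpper j) (16 ^ j)) ⟩
  wallisUpper j * (16 ^ d * 16 ^ j)
    ≡⟨ cong (wallisUpper j *_) (sym (^-distribˡ-+-* 16 d j)) ⟩
  wallisUpper j * 16 ^ (d + j) ∎)
  where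
  open ≤-Reasoning
  d = i ∸ j

wallis-product : ∀ J i j k →
  wallisLower i * wallisLower j * wallisLower k * (16 ^ J * 16 ^ J * 16) ≤
  wallisUpper J * wallisUpper J * wallisUpper (suc (i + j + k))
wallis-product J i j k = *-cancelʳ-≤ _ _ powers {{powers-nonZero}} (begin
  Li * Lj * Lk * (16 ^ J * 16 ^ J * 16) * powers
    ≡⟨ regroup Li Lj Lk (16 ^ J) powers ⟩
  (Li * 16 ^ J) * (Lj * 16 ^ J) * (Lk * (16 * powers))
    ≤⟨ *-mono-≤ (*-mono-≤ (wallis-sandwich i J) (wallis-sandwich j J)) last ⟩
  (UJ * 16 ^ i) * (UJ * 16 ^ j) * (Us * 16 ^ k)
    ≡⟨ collect UJ Us (16 ^ i) (16 ^ j) (16 ^ k) ⟩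
  UJ * UJ * Us * powers ∎)
  where
  open ≤-Reasoning
  Li = wallisLower i
  Lj = wallisLower j
  Lk = wallisLower k
  UJ = wallisUpper J
  Us = wallisUpper (suc (i + j + k))
  powers = 16 ^ i * 16 ^ j * 16 ^ k
  powers-nonZero : NonZero powers
  powers-nonZero = m*n≢0 (16 ^ i * 16 ^ j) (16 ^ k)
    {{m*n≢0 (16 ^ i) (16 ^ j) {{m^n≢0 16 i}} {{m^n≢0 16 j}}}} {{m^n≢0 16 k}}
  power : 16 ^ (i + j + k) ≡ powers
  power = trans (^-distribˡ-+-* 16 (i + j) k) (cong (_* 16 ^ k) (^-distribˡ-+-* 16 i j))
  last : Lk * (16 * powers) ≤ Us * 16 ^ k
  last = subst (λ e → Lk * (16 * e) ≤ Us * 16 ^ k) power (wallis-sandwich k (suc (i + j + k)))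
  regroup : ∀ x y z c p → x * y * z * (c * c * 16) * p ≡ (x * c) * (y * c) * (z * (16 * p))
  regroup = solve-∀
  collect : ∀ u v a b c → (u * a) * (u * b) * (v * c) ≡ u * u * v * (a * b * c)
  collect = solve-∀

quadratic-bound : ∀ m → (2 + m) * (2 * suc m + 1) ≤ 6 * (suc m * suc m)
quadratic-bound m = subst ((2 + m) * (2 * suc m + 1) ≤_) (expand m) (m≤m+n _ (4 * m * m + 5 * m))
  where
  expand : ∀ m → (2 + m) * (2 * suc m + 1) + (4 * m * m + 5 * m) ≡ 6 * (suc m * suc m)
  expand = solve-∀

wallisUpper-bound : ∀ m → wallisUpper (suc m) ≤ 12 * ((2 + m) * (markedTotal (2 + m) * markedTotal (2 + m)))
wallisUpper-bound m = begin
  wallisUpper (suc m)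
    ≡⟨ cong (λ x → 2 * (x * x * (2 * suc m + 1))) (central-unfold (suc m)) ⟩
  2 * ((2 + m) * c * ((2 + m) * c) * (2 * suc m + 1))
    ≡⟨ regroup (2 + m) c (2 * suc m + 1) ⟩
  2 * (2 + m) * c * c * ((2 + m) * (2 * suc m + 1))
    ≤⟨ *-monoʳ-≤ (2 * (2 + m) * c * c) (quadratic-bound m) ⟩
  2 * (2 + m) * c * c * (6 * (suc m * suc m))
    ≡⟨ collect (2 + m) c (suc m) ⟩
  12 * ((2 + m) * (suc m * c * (suc m * c))) ∎
  where
  open ≤-Reasoning
  c = treeCount (2 + m)
  regroup : ∀ n c r → 2 * (n * c * (n * c) * r) ≡ 2 * n * c * c * (n * r)
  regroup = solve-∀
  collect : ∀ n c s → 2 * n * c * c * (6 * (s * s)) ≡ 12 * (n * (s * c * (s * c)))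
  collect = solve-∀

wallisUpper-6 : wallisUpper 6 ≡ 22198176
wallisUpper-6 = cong (λ c → 2 * (c * c * (2 * 6 + 1))) central-6

wallisUpper-6-bound : 52 * 52 * 4 * 12 * (wallisUpper 6 * wallisUpper 6) ≤ 14400 * (16 ^ 6 * 16 ^ 6 * 16)
wallisUpper-6-bound =
  subst (λ u → 52 * 52 * 4 * 12 * (u * u) ≤ 14400 * (16 ^ 6 * 16 ^ 6 * 16)) (sym wallisUpper-6) (≤ᵇ⇒≤ _ _ _)

estimate-from-wallis : ∀ La Lb Lk U V s n T .{{_ : NonZero s}} →
  La * Lb * Lk * s ≤ U * U * V → V ≤ 12 * (n * (T * T)) → 52 * 52 * 4 * 12 * (U * U) ≤ 14400 * s →
  52 * 52 * (4 * (La * Lb * Lk)) ≤ n * (T * T * 14400)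
estimate-from-wallis La Lb Lk U V s n T LLL≤UUV V≤ UU≤s = *-cancelʳ-≤ _ _ s (begin
  52 * 52 * (4 * (La * Lb * Lk)) * s
    ≡⟨ regroup La Lb Lk s ⟩
  52 * 52 * 4 * (La * Lb * Lk * s)
    ≤⟨ *-monoʳ-≤ (52 * 52 * 4) LLL≤UUV ⟩
  52 * 52 * 4 * (U * U * V)
    ≤⟨ *-monoʳ-≤ (52 * 52 * 4) (*-monoʳ-≤ (U * U) V≤) ⟩
  52 * 52 * 4 * (U * U * (12 * (n * (T * T))))
    ≡⟨ collect U (n * (T * T)) ⟩
  52 * 52 * 4 * 12 * (U * U) * (n * (T * T))
    ≤⟨ *-monoˡ-≤ (n * (T * T)) UU≤s ⟩
  14400 * s * (n * (T * T))
    ≡⟨ finish s n T ⟩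
  n * (T * T * 14400) * s ∎)
  where
  open ≤-Reasoning
  regroup : ∀ x y z s → 52 * 52 * (4 * (x * y * z)) * s ≡ 52 * 52 * 4 * (x * y * z * s)
  regroup = solve-∀
  collect : ∀ u r → 52 * 52 * 4 * (u * u * (12 * r)) ≡ 52 * 52 * 4 * 12 * (u * u) * r
  collect = solve-∀
  finish : ∀ s n t → 14400 * s * (n * (t * t)) ≡ n * (t * t * 14400) * s
  finish = solve-∀

markedCount-wallisLower : ∀ a′ b′ k → let K = treeCount (suc a′) * treeCount (suc b′) * central k in
  K * K * 4 * (suc a′ * suc a′ * (4 * a′ + 1)) * (suc b′ * suc b′ * (4 * b′ + 1)) * (4 * k + 1)
  ≡ 4 * (wallisLower a′ * wallisLower b′ * wallisLower k)
markedCount-wallisLower a′ b′ k = begin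
  ca * cb * ck * (ca * cb * ck) * 4 * (a * a * A) * (b * b * B) * (4 * k + 1)
    ≡⟨ regroup ca cb ck a b A B (4 * k + 1) ⟩
  4 * ((a * ca) * (a * ca) * A * ((b * cb) * (b * cb) * B) * wallisLower k)
    ≡⟨ cong₂ (λ x y → 4 * (x * y * wallisLower k)) (lower a′) (lower b′) ⟩
  4 * (wallisLower a′ * wallisLower b′ * wallisLower k) ∎
  where
  open ≡-Reasoning
  a = suc a′
  b = suc b′
  A = 4 * a′ + 1
  B = 4 * b′ + 1
  ca = treeCount a
  cb = treeCount b
  ck = central k
  lower : ∀ j → suc j * treeCount (suc j) * (suc j * treeCount (suc j)) * (4 * j + 1) ≡ wallisLower j
  lower j = cong (λ x → x * x * (4 * j + 1)) (sym (central-unfold j))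
  regroup : ∀ ca cb ck a b A B G →
    ca * cb * ck * (ca * cb * ck) * 4 * (a * a * A) * (b * b * B) * G ≡
    4 * ((a * ca) * (a * ca) * A * ((b * cb) * (b * cb) * B) * (ck * ck * G))
  regroup = solve-∀

-- Two factors are compared with wallisUpper 6 and the third with wallisUpper (n − 1); the excess of
-- 52/15 over π is absorbed because wallisUpper 6 / 16^6 is already close to 4/π.
catalan-estimate : ∀ a′ b′ k → let m = a′ + b′ + k; T = markedTotal (2 + m)
                                   K = treeCount (suc a′) * treeCount (suc b′) * central k in
  52 * 52 * (K * K * 4 * (suc a′ * suc a′ * (4 * a′ + 1)) * (suc b′ * suc b′ * (4 * b′ + 1)) * (4 * k + 1))
  ≤ (2 + m) * (T * T * 14400)
catalan-estimate a′ b′ k =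
  subst (λ x → 52 * 52 * x ≤ (2 + m) * (T * T * 14400)) (sym (markedCount-wallisLower a′ b′ k))
    (estimate-from-wallis (wallisLower a′) (wallisLower b′) (wallisLower k) (wallisUpper 6) (wallisUpper (suc m))
                 (16 ^ 6 * 16 ^ 6 * 16) (2 + m) T
                 (wallis-product 6 a′ b′ k) (wallisUpper-bound m) wallisUpper-6-bound)
  where
  m = a′ + b′ + k
  T = markedTotal (2 + m)

open import Data.Integer as ℤ using (+_)
import Data.Integer.Properties as ℤ

ℚ-ring : AlmostCommutativeRing 0ℓ 0ℓ
ℚ-ring = fromCommutativeRing ℚ.+-*-commutativeRing (λ p → dec⇒maybe (0ℚ ℚ.≟ p))

toℚᵘ-ratio : ∀ k d → toℚᵘ (ratio k (suc d)) ℚᵘ.≃ mkℚᵘ (+ k) d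
toℚᵘ-ratio k d = ℚ.toℚᵘ-fromℚᵘ (mkℚᵘ (+ k) d)

ratio-cong : ∀ k d l e → k * suc e ≡ l * suc d → ratio k (suc d) ≡ ratio l (suc e)
ratio-cong k d l e eq = ℚ.toℚᵘ-injective (ℚᵘ.≃-trans (toℚᵘ-ratio k d)
  (ℚᵘ.≃-trans (*≡* (trans (sym (ℤ.pos-* k (suc e))) (trans (cong +_ eq) (ℤ.pos-* l (suc d)))))
              (ℚᵘ.≃-sym (toℚᵘ-ratio l e))))

ratio-mono : ∀ k d l e → k * suc e ≤ l * suc d → ratio k (suc d) ≤ℚ ratio l (suc e)
ratio-mono k d l e le = ℚ.toℚᵘ-cancel-≤ (ℚᵘ.≤-respˡ-≃ (ℚᵘ.≃-sym (toℚᵘ-ratio k d))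
  (ℚᵘ.≤-respʳ-≃ (ℚᵘ.≃-sym (toℚᵘ-ratio l e))
    (*≤* (subst₂ ℤ._≤_ (ℤ.pos-* k (suc e)) (ℤ.pos-* l (suc d)) (ℤ.+≤+ le)))))

ratio-* : ∀ k d l e → ratio k (suc d) *ℚ ratio l (suc e) ≡ ratio (k * l) (suc d * suc e)
ratio-* k d l e = ℚ.toℚᵘ-injective (ℚᵘ.≃-trans (ℚ.toℚᵘ-homo-* (ratio k (suc d)) (ratio l (suc e)))
  (ℚᵘ.≃-trans (ℚᵘ.*-cong (toℚᵘ-ratio k d) (toℚᵘ-ratio l e))
    (ℚᵘ.≃-trans (ℚᵘ.≃-reflexive (cong (λ i → mkℚᵘ i (e + d * suc e)) (sym (ℤ.pos-* k l))))
                (ℚᵘ.≃-sym (toℚᵘ-ratio (k * l) (e + d * suc e))))))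

ratio-+ : ∀ k d l e → ratio k (suc d) +ℚ ratio l (suc e) ≡ ratio (k * suc e + l * suc d) (suc d * suc e)
ratio-+ k d l e = ℚ.toℚᵘ-injective (ℚᵘ.≃-trans (ℚ.toℚᵘ-homo-+ (ratio k (suc d)) (ratio l (suc e)))
  (ℚᵘ.≃-trans (ℚᵘ.+-cong (toℚᵘ-ratio k d) (toℚᵘ-ratio l e))
    (ℚᵘ.≃-trans (ℚᵘ.≃-reflexive (cong (λ i → mkℚᵘ i (e + d * suc e)) numerator))
                (ℚᵘ.≃-sym (toℚᵘ-ratio (k * suc e + l * suc d) (e + d * suc e))))))
  where
  numerator : + k ℤ.* + suc e ℤ.+ + l ℤ.* + suc d ≡ + (k * suc e + l * suc d)
  numerator = sym (trans (ℤ.pos-+ (k * suc e) (l * suc d)) (cong₂ ℤ._+_ (ℤ.pos-* k (suc e)) (ℤ.pos-* l (suc d))))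

ratio-*-denominator : ∀ k d .{{_ : NonZero d}} → ratio k d *ℚ q d ≡ q k
ratio-*-denominator k (suc d) = trans (ratio-* k d (suc d) 0) (ratio-cong (k * suc d) (d * 1) k 0 (lemma k d))
  where
  lemma : ∀ k d → k * suc d * 1 ≡ k * suc (d * 1)
  lemma = solve-∀

q-* : ∀ m n → q m *ℚ q n ≡ q (m * n)
q-* m n = ratio-* m 0 n 0

q-*₃ : ∀ x y z → q x *ℚ q y *ℚ q z ≡ q (x * y * z)
q-*₃ x y z = trans (cong (_*ℚ q z) (q-* x y)) (q-* (x * y) z)

q-+ : ∀ m n → q m +ℚ q n ≡ q (m + n)
q-+ m n = trans (ratio-+ m 0 n 0) (ratio-cong (m * 1 + n * 1) 0 (m + n) 0 (lemma m n))
  where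
  lemma : ∀ m n → (m * 1 + n * 1) * 1 ≡ (m + n) * 1
  lemma = solve-∀

q-mono : ∀ {m n} → m ≤ n → q m ≤ℚ q n
q-mono {m} {n} m≤n = ratio-mono m 0 n 0 (subst₂ _≤_ (sym (*-identityʳ m)) (sym (*-identityʳ n)) m≤n)

q-nonNeg : ∀ n → NonNegative (q n)
q-nonNeg n = ℚ.normalize-nonNeg n 1

q-pos : ∀ n .{{_ : NonZero n}} → Positive (q n)
q-pos n = ℚ.normalize-pos n 1

q-monomial : ∀ K f a A b B G →
  q K *ℚ q K *ℚ q f *ℚ (q a *ℚ q a *ℚ q A) *ℚ (q b *ℚ q b *ℚ q B) *ℚ q G ≡ q (K * K * f * (a * a * A) * (b * b * B) * G)
q-monomial K f a A b B G = begin
  q K *ℚ q K *ℚ q f *ℚ (q a *ℚ q a *ℚ q A) *ℚ (q b *ℚ q b *ℚ q B) *ℚ q G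
    ≡⟨ cong₂ (λ u w → u *ℚ w *ℚ q G) (cong₂ _*ℚ_ (q-*₃ K K f) (q-*₃ a a A)) (q-*₃ b b B) ⟩
  q (K * K * f) *ℚ q (a * a * A) *ℚ q (b * b * B) *ℚ q G
    ≡⟨ cong (_*ℚ q G) (q-*₃ (K * K * f) (a * a * A) (b * b * B)) ⟩
  q (K * K * f * (a * a * A) * (b * b * B)) *ℚ q G
    ≡⟨ q-* (K * K * f * (a * a * A) * (b * b * B)) G ⟩
  q (K * K * f * (a * a * A) * (b * b * B) * G) ∎
  where open ≡-Reasoning

square-mono : ∀ {u v} → 0ℚ ≤ℚ u → u ≤ℚ v → u *ℚ u ≤ℚ v *ℚ v
square-mono {u} {v} 0≤u u≤v = ℚ.≤-trans
  (ℚ.*-monoˡ-≤-nonNeg u {{ℚ.nonNegative 0≤u}} u≤v)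
  (ℚ.*-monoʳ-≤-nonNeg v {{ℚ.nonNegative (ℚ.≤-trans 0≤u u≤v)}} u≤v)

p≤r⇒0≤r-p : ∀ {p r} → p ≤ℚ r → 0ℚ ≤ℚ r -ℚ p
p≤r⇒0≤r-p {p} {r} p≤r = subst (_≤ℚ r -ℚ p) (ℚ.+-inverseʳ p) (ℚ.+-monoˡ-≤ (ℚ.- p) p≤r)

reciprocal-antitone : ∀ u v .{{_ : NonZero u}} .{{_ : NonZero v}} → u ≤ v → (+ 1) / v ≤ℚ (+ 1) / u
reciprocal-antitone (suc u) (suc v) u≤v =
  ratio-mono 1 v 1 u (subst₂ _≤_ (sym (*-identityˡ (suc u))) (sym (*-identityˡ (suc v))) u≤v)

-- The Leibniz bound on π

leibniz-step-nonNeg : ∀ m → 0ℚ ≤ℚ q 4 *ℚ ((+ 1) / (4 * suc m + 1) -ℚ (+ 1) / (4 * suc m + 3))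
leibniz-step-nonNeg m = subst (_≤ℚ q 4 *ℚ (r₁ -ℚ r₃)) (ℚ.*-zeroʳ (q 4))
  (ℚ.*-monoˡ-≤-nonNeg (q 4) {{q-nonNeg 4}} (p≤r⇒0≤r-p r₃≤r₁))
  where
  r₁ r₃ : ℚ
  r₁ = (+ 1) / (4 * suc m + 1)
  r₃ = (+ 1) / (4 * suc m + 3)
  r₃≤r₁ : r₃ ≤ℚ r₁
  r₃≤r₁ = reciprocal-antitone (4 * suc m + 1) (4 * suc m + 3) (+-monoʳ-≤ (4 * suc m) (s≤s z≤n))

piLower-nonNeg : ∀ m → 0ℚ ≤ℚ piLower m
piLower-nonNeg zero    = ℚ.≤ᵇ⇒≤ _
piLower-nonNeg (suc m) =
  subst (_≤ℚ piLower (suc m)) (ℚ.+-identityʳ 0ℚ) (ℚ.+-mono-≤ (piLower-nonNeg m) (leibniz-step-nonNeg m))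

-- piLower m and piUpper m are consecutive partial sums of the Leibniz series, and piUpper 0 = 52/15.
piUpper : ℕ → ℚ
piUpper m = piLower m +ℚ q 4 *ℚ ((+ 1) / (4 * suc m + 1))

piUpper-antitone : ∀ m → piUpper (suc m) ≤ℚ piUpper m
piUpper-antitone m = begin
  piLower m +ℚ q 4 *ℚ (r₁ -ℚ r₃) +ℚ q 4 *ℚ r₅
    ≤⟨ ℚ.+-monoʳ-≤ (piLower m +ℚ q 4 *ℚ (r₁ -ℚ r₃)) (ℚ.*-monoˡ-≤-nonNeg (q 4) {{q-nonNeg 4}} r₅≤r₃) ⟩
  piLower m +ℚ q 4 *ℚ (r₁ -ℚ r₃) +ℚ q 4 *ℚ r₃
    ≡⟨ telescope (piLower m) (q 4) r₁ r₃ ⟩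
  piLower m +ℚ q 4 *ℚ r₁ ∎
  where
  open ℚ.≤-Reasoning
  r₁ r₃ r₅ : ℚ
  r₁ = (+ 1) / (4 * suc m + 1)
  r₃ = (+ 1) / (4 * suc m + 3)
  r₅ = (+ 1) / (4 * suc (suc m) + 1)
  r₅≤r₃ : r₅ ≤ℚ r₃
  r₅≤r₃ = reciprocal-antitone (4 * suc m + 3) (4 * suc (suc m) + 1) (subst (4 * suc m + 3 ≤_) (shift m) (m≤m+n _ 2))
    where
    shift : ∀ m → 4 * suc m + 3 + 2 ≡ 4 * suc (suc m) + 1
    shift = solve-∀
  telescope : ∀ a f x y → a +ℚ f *ℚ (x -ℚ y) +ℚ f *ℚ y ≡ a +ℚ f *ℚ x
  telescope = Tactic.RingSolver.solve-∀ ℚ-ring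

piLower≤52/15 : ∀ m → piLower m ≤ℚ (+ 52) / 15
piLower≤52/15 m = ℚ.≤-trans (below m) (above m)
  where
  below : ∀ m → piLower m ≤ℚ piUpper m
  below m = subst (_≤ℚ piUpper m) (ℚ.+-identityʳ (piLower m))
    (ℚ.+-monoʳ-≤ (piLower m) (ℚ.nonNegative⁻¹ (q 4 *ℚ r) {{ℚ.nonNeg*nonNeg⇒nonNeg (q 4) {{q-nonNeg 4}} r {{r-nonNeg}}}}))
    where
    r = (+ 1) / (4 * suc m + 1)
    r-nonNeg : NonNegative r
    r-nonNeg = ℚ.normalize-nonNeg 1 (4 * suc m + 1)
  above : ∀ m → piUpper m ≤ℚ (+ 52) / 15
  above zero    = ℚ.≤ᵇ⇒≤ _
  above (suc m) = ℚ.≤-trans (piUpper-antitone m) (above m)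

piLower*15≤52 : ∀ m → piLower m *ℚ q 15 ≤ℚ q 52
piLower*15≤52 m = subst (piLower m *ℚ q 15 ≤ℚ_) (ratio-*-denominator 52 14)
  (ℚ.*-monoʳ-≤-nonNeg (q 15) {{q-nonNeg 15}} (piLower≤52/15 m))

sub-¾ : ∀ a → (q (suc a) -ℚ (+ 3) / 4) *ℚ q 4 ≡ q (4 * a + 1)
sub-¾ a = begin
  (q (suc a) -ℚ r) *ℚ q 4
    ≡⟨ distrib (q (suc a)) r (q 4) ⟩
  q (suc a) *ℚ q 4 -ℚ r *ℚ q 4
    ≡⟨ cong₂ _-ℚ_ (trans (q-* (suc a) 4) (cong q (split a))) (ratio-*-denominator 3 3) ⟩
  q (4 * a + 1 + 3) -ℚ q 3
    ≡⟨ cong (_-ℚ q 3) (sym (q-+ (4 * a + 1) 3)) ⟩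
  q (4 * a + 1) +ℚ q 3 -ℚ q 3
    ≡⟨ cancel (q (4 * a + 1)) (q 3) ⟩
  q (4 * a + 1) ∎
  where
  open ≡-Reasoning
  r = (+ 3) / 4
  distrib : ∀ x y z → (x -ℚ y) *ℚ z ≡ x *ℚ z -ℚ y *ℚ z
  distrib = Tactic.RingSolver.solve-∀ ℚ-ring
  cancel : ∀ x y → x +ℚ y -ℚ y ≡ x
  cancel = Tactic.RingSolver.solve-∀ ℚ-ring
  split : ∀ a → suc a * 4 ≡ 4 * a + 1 + 3
  split = solve-∀

add-¼ : ∀ k → (q k +ℚ (+ 1) / 4) *ℚ q 4 ≡ q (4 * k + 1)
add-¼ k = begin
  (q k +ℚ (+ 1) / 4) *ℚ q 4
    ≡⟨ ℚ.*-distribʳ-+ (q 4) (q k) ((+ 1) / 4) ⟩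
  q k *ℚ q 4 +ℚ (+ 1) / 4 *ℚ q 4
    ≡⟨ cong₂ _+ℚ_ (q-* k 4) (ratio-*-denominator 1 3) ⟩
  q (k * 4) +ℚ q 1
    ≡⟨ q-+ (k * 4) 1 ⟩
  q (k * 4 + 1)
    ≡⟨ cong (λ x → q (x + 1)) (*-comm k 4) ⟩
  q (4 * k + 1) ∎
  where open ≡-Reasoning

-- 14400 = 15² · 4³ clears the denominators of π ≤ 52/15 and of the three quarters.
rational-bound : ∀ (p x y z π : ℚ) K T a A b B G n .{{_ : NonZero T}} →
  p *ℚ q T ≡ q K → x *ℚ q 4 ≡ q A → y *ℚ q 4 ≡ q B → z *ℚ q 4 ≡ q G →
  0ℚ ≤ℚ π → π *ℚ q 15 ≤ℚ q 52 →
  52 * 52 * (K * K * 4 * (a * a * A) * (b * b * B) * G) ≤ n * (T * T * 14400) →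
  p *ℚ p *ℚ q 4 *ℚ (π *ℚ π) *ℚ (q a *ℚ q a *ℚ x) *ℚ (q b *ℚ q b *ℚ y) *ℚ z ≤ℚ q n
rational-bound p x y z π K T a A b B G n pT≡K x4≡A y4≡B z4≡G 0≤π π15≤52 N≤nD =
  ℚ.*-cancelʳ-≤-pos M {{M-pos}} (begin
    p *ℚ p *ℚ q 4 *ℚ (π *ℚ π) *ℚ (q a *ℚ q a *ℚ x) *ℚ (q b *ℚ q b *ℚ y) *ℚ z *ℚ M
      ≡⟨ regroup p x y z π (q T) (q a) (q b) (q 4) (q 15) ⟩
    (π *ℚ q 15) *ℚ (π *ℚ q 15) *ℚ E (p *ℚ q T) (x *ℚ q 4) (y *ℚ q 4) (z *ℚ q 4)
      ≡⟨ cong ((π *ℚ q 15) *ℚ (π *ℚ q 15) *ℚ_) (trans (substitute pT≡K x4≡A y4≡B z4≡G) (q-monomial K 4 a A b B G)) ⟩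
    (π *ℚ q 15) *ℚ (π *ℚ q 15) *ℚ q N
      ≤⟨ ℚ.*-monoʳ-≤-nonNeg (q N) {{q-nonNeg N}} (square-mono 0≤π15 π15≤52) ⟩
    q 52 *ℚ q 52 *ℚ q N
      ≡⟨ q-*₃ 52 52 N ⟩
    q (52 * 52 * N)
      ≤⟨ q-mono N≤nD ⟩
    q (n * (T * T * 14400))
      ≡⟨ sym (trans (cong (q n *ℚ_) (q-*₃ T T 14400)) (q-* n _)) ⟩
    q n *ℚ M ∎)
  where
  open ℚ.≤-Reasoning
  N = K * K * 4 * (a * a * A) * (b * b * B) * G
  M = q T *ℚ q T *ℚ q 14400
  M-pos : Positive M
  M-pos = ℚ.pos*pos⇒pos (q T *ℚ q T) {{ℚ.pos*pos⇒pos (q T) {{q-pos T}} (q T) {{q-pos T}}}} (q 14400) {{q-pos 14400}}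
  0≤π15 : 0ℚ ≤ℚ π *ℚ q 15
  0≤π15 = ℚ.nonNegative⁻¹ (π *ℚ q 15) {{ℚ.nonNeg*nonNeg⇒nonNeg π {{ℚ.nonNegative 0≤π}} (q 15) {{q-nonNeg 15}}}}
  E : ℚ → ℚ → ℚ → ℚ → ℚ
  E u v w s = u *ℚ u *ℚ q 4 *ℚ (q a *ℚ q a *ℚ v) *ℚ (q b *ℚ q b *ℚ w) *ℚ s
  substitute : ∀ {u u′ v v′ w w′ s s′} → u ≡ u′ → v ≡ v′ → w ≡ w′ → s ≡ s′ → E u v w s ≡ E u′ v′ w′ s′
  substitute refl refl refl refl = refl
  regroup : ∀ p x y z π τ α β f g →
    p *ℚ p *ℚ f *ℚ (π *ℚ π) *ℚ (α *ℚ α *ℚ x) *ℚ (β *ℚ β *ℚ y) *ℚ z *ℚ (τ *ℚ τ *ℚ (g *ℚ g *ℚ (f *ℚ f *ℚ f)))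
    ≡ (π *ℚ g) *ℚ (π *ℚ g) *ℚ ((p *ℚ τ) *ℚ (p *ℚ τ) *ℚ f *ℚ (α *ℚ α *ℚ (x *ℚ f)) *ℚ (β *ℚ β *ℚ (y *ℚ f)) *ℚ (z *ℚ f))
  regroup = Tactic.RingSolver.solve-∀ ℚ-ring

SquaredBound : ℕ → ℕ → ℕ → ℕ → Set
SquaredBound n a b m =
  P a b n *ℚ P a b n *ℚ q 4 *ℚ (piLower m *ℚ piLower m)
    *ℚ (q a *ℚ q a *ℚ (q a -ℚ (+ 3) / 4))
    *ℚ (q b *ℚ q b *ℚ (q b -ℚ (+ 3) / 4))
    *ℚ (q (n ∸ a ∸ b) +ℚ (+ 1) / 4)
    ≤ℚ q n

P*markedTotal : ∀ a′ b′ k → let n = 2 + (a′ + b′ + k) in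
  P (suc a′) (suc b′) n *ℚ q (markedTotal n) ≡ q (treeCount (suc a′) * treeCount (suc b′) * central k)
P*markedTotal a′ b′ k = begin
  P a b n *ℚ q T
    ≡⟨ cong₂ (λ x y → ratio x y *ℚ q T) (trans (markedLR-pairCount a b n) (markedCount-closed a b′ n)) (markedLR-length n) ⟩
  ratio (cc * leafSum (n ∸ (a + b′))) T *ℚ q T
    ≡⟨ ratio-*-denominator (cc * leafSum (n ∸ (a + b′))) T {{markedTotal-nonZero (a′ + b′ + k)}} ⟩
  q (cc * leafSum (n ∸ (a + b′)))
    ≡⟨ cong (λ x → q (cc * x)) (trans (cong leafSum rest) (trans (leafSum-closed (suc k)) (sym (central-unfold k)))) ⟩
  q (cc * central k) ∎
  where
  open ≡-Reasoning
  a = suc a′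
  b = suc b′
  n = 2 + (a′ + b′ + k)
  T = markedTotal n
  cc = treeCount a * treeCount b
  rest : n ∸ (a + b′) ≡ suc k
  rest = trans (cong (_∸ (a′ + b′)) (sym (+-suc (a′ + b′) k))) (m+n∸m≡n (a′ + b′) (suc k))

squaredBound : ∀ a′ b′ k m → SquaredBound (2 + (a′ + b′ + k)) (suc a′) (suc b′) m
squaredBound a′ b′ k m =
  rational-bound (P a b n) (q a -ℚ (+ 3) / 4) (q b -ℚ (+ 3) / 4) (q (n ∸ a ∸ b) +ℚ (+ 1) / 4) (piLower m)
    K (markedTotal n) a (4 * a′ + 1) b (4 * b′ + 1) (4 * k + 1) n {{markedTotal-nonZero (a′ + b′ + k)}}
    (P*markedTotal a′ b′ k) (sub-¾ a′) (sub-¾ b′) (trans (add-¼ (n ∸ a ∸ b)) (cong (λ j → q (4 * j + 1)) rest))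
    (piLower-nonNeg m) (piLower*15≤52 m) (catalan-estimate a′ b′ k)
  where
  a = suc a′
  b = suc b′
  n = 2 + (a′ + b′ + k)
  K = treeCount a * treeCount b * central k
  rest : n ∸ a ∸ b ≡ k
  rest = trans (∸-+-assoc n a b) (trans (cong (_∸ (a + b)) (size a′ b′ k)) (m+n∸m≡n (a + b) k))
    where
    size : ∀ a′ b′ k → 2 + (a′ + b′ + k) ≡ suc a′ + suc b′ + k
    size = solve-∀

corollary6p11 : (n a b : ℕ) → 2 ≤ n → 1 ≤ a → 1 ≤ b → a + b ≤ n →
    (m : ℕ) →
    P a b n *ℚ P a b n *ℚ q 4 *ℚ (piLower m *ℚ piLower m)
      *ℚ (q a *ℚ q a *ℚ (q a -ℚ (+ 3) / 4))
      *ℚ (q b *ℚ q b *ℚ (q b -ℚ (+ 3) / 4))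
      *ℚ (q (n ∸ a ∸ b) +ℚ (+ 1) / 4)
      ≤ℚ q n
corollary6p11 n (suc a′) (suc b′) _ (s≤s z≤n) (s≤s z≤n) a+b≤n m =
  subst (λ n → SquaredBound n (suc a′) (suc b′) m) size (squaredBound a′ b′ k m)
  where
  k = n ∸ suc a′ ∸ suc b′
  size : 2 + (a′ + b′ + k) ≡ n
  size = begin
    2 + (a′ + b′ + k)         ≡⟨ regroup a′ b′ k ⟩
    suc a′ + suc b′ + k       ≡⟨ cong (λ j → suc a′ + suc b′ + j) (∸-+-assoc n (suc a′) (suc b′)) ⟩
    suc a′ + suc b′ + (n ∸ (suc a′ + suc b′)) ≡⟨ m+[n∸m]≡n a+b≤n ⟩
    n                         ∎
    where
    open ≡-Reasoning
    regroup : ∀ a′ b′ k → 2 + (a′ + b′ + k) ≡ suc a′ + suc b′ + k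
    regroup = solve-∀
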